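{- Let $0<e_0\le 1$. For every instance of $P_m, e_{i,k}\ge e_0\mid\mid C_{\max}$, every list schedule (for an arbitrary job list) has makespan $C_{\max}(LS)$ satisfying $\frac{C_{\max}(LS)}{C^*_{\max}}\le 1+\frac{1}{e_0}$, where $C^*_{\max}$ is the optimal makespan.
   Context: Shared-processing scheduling model: $m$ identical parallel machines $M_1,\dots,M_m$; $n$ primary jobs available at time $0$, job $j$ with processing time $p_j>0$, each processed without interruption on one machine. The time axis of each $M_i$ is partitioned into consecutive intervals $(0,t_{i,1}],(t_{i,1},t_{i,2}],\dots$ with sharing ratios $e_{i,1},e_{i,2},\dots\in(0,1]$; during an interval with ratio $e$ a primary job on that machine receives $e$ units of processing per unit of time. Jobs on a machine are processed consecutively; a job with processing time $p$ started at time $s$ on $M_i$ completes at the earliest $C$ with $\int_s^C e_i(t)dt=p$, $e_i(t)$ the ratio of $M_i$ at time $t$. Makespan $C_{\max}=\max_j C_j$. The problem $P_m, e_{i,k}\ge e_0\mid\mid C_{\max}$ is the makespan minimization problem in which all sharing ratios on all machines satisfy $e_{i,k}\ge e_0$. List Scheduling (LS): given an ordered list of the jobs, the jobs are taken one by one in list order and each is appended to the machine that becomes available earliest (i.e. on which it can start earliest), starting at that time.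
   Formalization: The processing times $p_j$, the interval endpoints, the sharing ratios $e_{i,k}$, the bound $e_0$ and all start and completion times of schedules are rational. -}

module Defs where

open import Data.Nat using (ℕ; zero; suc)
open import Data.Fin using (Fin; _≟_)
open import Data.Rational using (ℚ; 0ℚ; 1ℚ; _+_; _*_; _-_; _≤_; _<_; _⊔_; 1/_; positive)
open import Data.Rational.Properties using (pos⇒nonZero)
open import Data.List using (List; []; _∷_; foldr; map; allFin)
open import Data.Product using (Σ; ∃; ∃-syntax; _×_; _,_)
open import Data.Sum using (_⊎_)
open import Relation.Binary.PropositionalEquality using (_≡_; _≢_)
open import Relation.Nullary using (yes; no)

-- Sharing profile of one machine: breakpoints t 0 = 0 < t 1 < t 2 < ... (unbounded),
-- interval k is (t k , t (suc k)] with sharing ratio e k ∈ (0,1].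
record Profile : Set where
  field
    t      : ℕ → ℚ
    e      : ℕ → ℚ
    t₀     : t 0 ≡ 0ℚ
    t-inc  : ∀ k → t k < t (suc k)
    t-unb  : ∀ (T : ℚ) → ∃[ k ] (T ≤ t k)
    e-pos  : ∀ k → 0ℚ < e k
    e≤1    : ∀ k → e k ≤ 1ℚ
open Profile public

-- Cumulative processing capacity ∫₀^{t k} e(τ) dτ at breakpoint k.
cumBreak : Profile → ℕ → ℚ
cumBreak P zero    = 0ℚ
cumBreak P (suc k) = cumBreak P k + e P k * (t P (suc k) - t P k)

-- CumAt P x v  :⇔  ∫₀^x e(τ) dτ = v   (for x ≥ 0)
CumAt : Profile → ℚ → ℚ → Set
CumAt P x v = ∃[ k ] (t P k ≤ x × x ≤ t P (suc k) × v ≡ cumBreak P k + e P k * (x - t P k))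

-- A job with processing time p started at s completes at C:  ∫ₛ^C e(τ) dτ = p.
Completes : Profile → ℚ → ℚ → ℚ → Set
Completes P s p C = ∃[ a ] ∃[ b ] (CumAt P s a × CumAt P C b × b - a ≡ p)

-- An instance of  P_m, e_{i,k} ≥ e₀ || C_max  (the bound e₀ is a hypothesis of the theorem).
record Instance (m n : ℕ) : Set where
  field
    p      : Fin n → ℚ
    p-pos  : ∀ j → 0ℚ < p j
    prof   : Fin m → Profile
open Instance public

makespan : ∀ {n} → (Fin n → ℚ) → ℚ
makespan {n} C = foldr _⊔_ 0ℚ (map C (allFin n))

record Schedule {m n : ℕ} (I : Instance m n) : Set where
  field
    machine   : Fin n → Fin m
    start     : Fin n → ℚ
    finish    : Fin n → ℚ
    start≥0   : ∀ j → 0ℚ ≤ start j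
    completes : ∀ j → Completes (prof I (machine j)) (start j) (p I j) (finish j)
    disjoint  : ∀ j j' → j ≢ j' → machine j ≡ machine j' →
                finish j ≤ start j' ⊎ finish j' ≤ start j
open Schedule public

update : ∀ {m} → (Fin m → ℚ) → Fin m → ℚ → Fin m → ℚ
update a i v i' with i' ≟ i
... | yes _ = v
... | no  _ = a i'

-- ListSched I a js C : processing the job list js by List Scheduling, starting from
-- machine availability times a, yields completion times C j for the jobs j in js.
data ListSched {m n : ℕ} (I : Instance m n) : (Fin m → ℚ) → List (Fin n) → (Fin n → ℚ) → Set where
  done : ∀ {a C} → ListSched I a [] C
  step : ∀ {a j js C} (i : Fin m) →
         (∀ i' → a i ≤ a i') →
         Completes (prof I i) (a i) (p I j) (C j) →
         ListSched I (update a i (C j)) js C →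
         ListSched I a (j ∷ js) C

bound : (e₀ : ℚ) → 0ℚ < e₀ → ℚ
bound e₀ h = 1ℚ + (1/ e₀) {{pos⇒nonZero e₀ {{positive h}}}}

{-# OPTIONS --safe #-}
module Submission where

-- Let C* be the makespan of any feasible schedule (e.g. an optimal one) and W = Σᵢ ∫₀^C* eᵢ the
-- processing capacity of all machines up to C*. That schedule processes every job inside [0, C*] on
-- one machine without overlaps, so Σⱼ pⱼ ≤ W. List Scheduling keeps the invariant "capacity already
-- consumed by the machines plus the work still to be scheduled is at most W". Hence, when a job is
-- started, the earliest available machine is free by C* (otherwise every machine would already
-- have consumed more than its capacity up to C*). The job needs pⱼ ≤ C* units of processing at a
-- rate of at least e₀, so it completes within C*/e₀ of its start.

open import Defs
open import Data.Bool using (if_then_else_)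
open import Data.Fin using (Fin; zero; suc; _≟_; punchIn)
open import Data.Fin.Properties using (punchInᵢ≢i; suc-injective)
open import Data.List using (List; []; _∷_; foldr; map; tabulate; allFin)
open import Data.List.Membership.Propositional using (_∈_)
open import Data.List.Membership.Propositional.Properties using (∈-allFin)
open import Data.List.Relation.Unary.Any using (here; there)
open import Data.List.Relation.Binary.Permutation.Propositional using (_↭_; ↭-sym; ↭⇒↭ₛ)
open import Data.List.Relation.Binary.Permutation.Propositional.Properties using (map⁺; ∈-resp-↭)
open import Data.List.Relation.Binary.Permutation.Setoid.Properties using (foldr-commMonoid)
open import Data.Nat using (ℕ; zero; suc; _≤′_; ≤′-refl; ≤′-step)
import Data.Nat.Properties as ℕ
open import Data.Product using (∃-syntax; _×_; _,_; proj₁; proj₂)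
open import Data.Rational
  using (ℚ; 0ℚ; 1ℚ; _≤_; _<_; _+_; _*_; _-_; -_; _≤?_; _⊔_; 1/_; NonZero; positive; nonNegative)
open import Data.Rational.Properties hiding (_≟_)
open import Data.Rational.Solver using (module +-*-Solver)
open import Data.Sum using (_⊎_; inj₁; inj₂)
open import Data.Vec.Functional using (Vector)
open import Function using (_∘_; id)
open import Level using (0ℓ)
open import Relation.Binary.PropositionalEquality
open import Relation.Nullary using (¬_; Dec; yes; no; does; contradiction)
open import Relation.Nullary.Decidable using (_×-dec_; dec-true; dec-false)
open import Relation.Unary using (Pred; Decidable)

open +-*-Solver using (solve; _:=_; _:+_; _:-_; _:*_; con)
open import Algebra.Properties.CommutativeMonoid.Sum +-0-commutativeMonoid
  using (sum; sum-syntax; sum-cong-≗; sum-remove; sum-replicate-zero; ∑-comm; ∑-distrib-+)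
open import Algebra.Properties.Group +-0-group using (x∙y⁻¹≈ε⇒x≈y)

x+[y-x]≡y : ∀ x y → x + (y - x) ≡ y
x+[y-x]≡y = solve 2 (λ x y → x :+ (y :- x) := y) refl

x≤y⇒0≤y-x : ∀ {x y} → x ≤ y → 0ℚ ≤ y - x
x≤y⇒0≤y-x {x} {y} x≤y = subst (_≤ y - x) (+-inverseʳ x) (+-monoˡ-≤ (- x) x≤y)

0≤y-x⇒x≤y : ∀ {x y} → 0ℚ ≤ y - x → x ≤ y
0≤y-x⇒x≤y {x} {y} 0≤y-x = subst₂ _≤_ (+-identityʳ x) (x+[y-x]≡y x y) (+-monoʳ-≤ x 0≤y-x)

x<y⇒0<y-x : ∀ {x y} → x < y → 0ℚ < y - x
x<y⇒0<y-x {x} {y} x<y = subst (_< y - x) (+-inverseʳ x) (+-monoˡ-< (- x) x<y)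

0<y-x⇒x<y : ∀ {x y} → 0ℚ < y - x → x < y
0<y-x⇒x<y {x} {y} 0<y-x = subst₂ _<_ (+-identityʳ x) (x+[y-x]≡y x y) (+-monoʳ-< x 0<y-x)

y-x≤y : ∀ {x y} → 0ℚ ≤ x → y - x ≤ y
y-x≤y {x} {y} 0≤x = subst (y - x ≤_) (+-identityʳ y) (+-monoʳ-≤ y (neg-antimono-≤ 0≤x))

completion≤bound* : ∀ {e₀} (0<e₀ : 0ℚ < e₀) {s C T} → s ≤ T → e₀ * (C - s) ≤ T → C ≤ bound e₀ 0<e₀ * T
completion≤bound* {e₀} 0<e₀ {s} {C} {T} s≤T e₀[C-s]≤T = begin
  C                  ≡⟨ x+[y-x]≡y s C ⟨
  s + (C - s)        ≤⟨ +-mono-≤ s≤T C-s≤T/e₀ ⟩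
  T + 1/ e₀ * T      ≡⟨ solve 2 (λ r T → T :+ r :* T := (con 1ℚ :+ r) :* T) refl (1/ e₀) T ⟩
  bound e₀ 0<e₀ * T  ∎
  where
  open ≤-Reasoning
  instance
    e₀≢0 : NonZero e₀
    e₀≢0 = pos⇒nonZero e₀ {{positive 0<e₀}}
  e₀*[T/e₀]≡T : e₀ * (1/ e₀ * T) ≡ T
  e₀*[T/e₀]≡T = trans (sym (*-assoc e₀ (1/ e₀) T)) (trans (cong (_* T) (*-inverseʳ e₀)) (*-identityˡ T))
  C-s≤T/e₀ : C - s ≤ 1/ e₀ * T
  C-s≤T/e₀ = *-cancelˡ-≤-pos e₀ {{positive 0<e₀}} (subst (e₀ * (C - s) ≤_) (sym e₀*[T/e₀]≡T) e₀[C-s]≤T)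

0≤bound* : ∀ {e₀} (0<e₀ : 0ℚ < e₀) {T} → 0ℚ ≤ T → 0ℚ ≤ bound e₀ 0<e₀ * T
0≤bound* {e₀} 0<e₀ {T} 0≤T = completion≤bound* 0<e₀ {s = 0ℚ} {C = 0ℚ} 0≤T
  (subst (_≤ T) (sym (trans (cong (e₀ *_) (+-inverseʳ 0ℚ)) (*-zeroʳ e₀))) 0≤T)

-- Band e₀ d u: d units of processing are received during u units of time at rates in [e₀, 1].
Band : ℚ → ℚ → ℚ → Set
Band e₀ d u = e₀ * u ≤ d × d ≤ u

module _ {e₀ : ℚ} where

  Band-0 : Band e₀ 0ℚ 0ℚ
  Band-0 = ≤-reflexive (*-zeroʳ e₀) , ≤-refl

  Band-+ : ∀ {d u d′ u′} → Band e₀ d u → Band e₀ d′ u′ → Band e₀ (d + d′) (u + u′)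
  Band-+ {u = u} {u′ = u′} (ℓ , r) (ℓ′ , r′) =
    subst (_≤ _) (sym (*-distribˡ-+ e₀ u u′)) (+-mono-≤ ℓ ℓ′) , +-mono-≤ r r′

  rate-Band : ∀ {r u} → e₀ ≤ r → r ≤ 1ℚ → 0ℚ ≤ u → Band e₀ (r * u) u
  rate-Band {r} {u} e₀≤r r≤1 0≤u =
    *-monoʳ-≤-nonNeg u {{nonNegative 0≤u}} e₀≤r ,
    subst (r * u ≤_) (*-identityˡ u) (*-monoʳ-≤-nonNeg u {{nonNegative 0≤u}} r≤1)

  Band-degenerate : ∀ {d} → Band e₀ d 0ℚ → d ≡ 0ℚ
  Band-degenerate (ℓ , r) = ≤-antisym r (subst (_≤ _) (*-zeroʳ e₀) ℓ)

  Band-nonneg : ∀ {d u} → 0ℚ ≤ e₀ → 0ℚ ≤ u → Band e₀ d u → 0ℚ ≤ d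
  Band-nonneg {u = u} 0≤e₀ 0≤u (ℓ , _) =
    ≤-trans (nonNegative⁻¹ _ {{nonNeg*nonNeg⇒nonNeg e₀ {{nonNegative 0≤e₀}} u {{nonNegative 0≤u}}}}) ℓ

  Band-pos : ∀ {d u} → 0ℚ < e₀ → 0ℚ < u → Band e₀ d u → 0ℚ < d
  Band-pos {u = u} 0<e₀ 0<u (ℓ , _) =
    <-≤-trans (positive⁻¹ _ {{pos*pos⇒pos e₀ {{positive 0<e₀}} u {{positive 0<u}}}}) ℓ

module Capacity {e₀ : ℚ} (0<e₀ : 0ℚ < e₀) (P : Profile) (e₀≤e : ∀ k → e₀ ≤ e P k) where

  t-mono : ∀ {k k′} → k ≤′ k′ → t P k ≤ t P k′
  t-mono ≤′-refl = ≤-refl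
  t-mono (≤′-step k≤k′) = ≤-trans (t-mono k≤k′) (<⇒≤ (t-inc P _))

  t-nonneg : ∀ k → 0ℚ ≤ t P k
  t-nonneg k = subst (_≤ t P k) (t₀ P) (t-mono ℕ.z≤′n)

  cumOn : ℕ → ℚ → ℚ
  cumOn k x = cumBreak P k + e P k * (x - t P k)

  cumOn-Band : ∀ k {x y} → x ≤ y → Band e₀ (cumOn k y - cumOn k x) (y - x)
  cumOn-Band k {x} {y} x≤y =
    subst (λ d → Band e₀ d (y - x))
          (solve 5 (λ c r x y t → r :* (y :- x) := (c :+ r :* (y :- t)) :- (c :+ r :* (x :- t))) refl
                 (cumBreak P k) (e P k) x y (t P k))
          (rate-Band (e₀≤e k) (e≤1 P k) (x≤y⇒0≤y-x x≤y))

  cumOn-breakpoint : ∀ k → cumOn (suc k) (t P (suc k)) ≡ cumOn k (t P (suc k))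
  cumOn-breakpoint k = solve 3 (λ c r t → c :+ r :* (t :- t) := c) refl
                             (cumBreak P (suc k)) (e P (suc k)) (t P (suc k))

  -- Over several segments the capacity telescopes through the intermediate breakpoints.
  cumOn-Band-across : ∀ {k k′ x y} → k ≤′ k′ → x ≤ t P (suc k) → t P k′ ≤ y → x ≤ y →
                      Band e₀ (cumOn k′ y - cumOn k x) (y - x)
  cumOn-Band-across {k} ≤′-refl _ _ x≤y = cumOn-Band k x≤y
  cumOn-Band-across {k} {suc k′} {x} {y} (≤′-step k≤k′) x≤tk tk′≤y _ =
    subst₂ (Band e₀)
      (trans (cong (λ c → cumOn (suc k′) y - c + (cumOn k′ b - cumOn k x)) (cumOn-breakpoint k′))
             (telescope (cumOn (suc k′) y) (cumOn k′ b) (cumOn k x)))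
      (telescope y b x)
      (Band-+ {e₀} (cumOn-Band (suc k′) tk′≤y)
              (cumOn-Band-across k≤k′ x≤tk (<⇒≤ (t-inc P k′)) (≤-trans x≤tk (t-mono (ℕ.s≤′s k≤k′)))))
    where
    b = t P (suc k′)
    telescope : ∀ x y z → (x - y) + (y - z) ≡ x - z
    telescope = solve 3 (λ x y z → (x :- y) :+ (y :- z) := x :- z) refl

  CumAt⇒0≤ : ∀ {x v} → CumAt P x v → 0ℚ ≤ x
  CumAt⇒0≤ (k , tk≤x , _) = ≤-trans (t-nonneg k) tk≤x

  cumOn-unique : ∀ {k k′ x} → k ≤′ k′ → x ≤ t P (suc k) → t P k′ ≤ x → cumOn k′ x ≡ cumOn k x
  cumOn-unique {x = x} k≤k′ x≤tk tk′≤x =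
    x∙y⁻¹≈ε⇒x≈y _ _ (Band-degenerate {e₀}
      (subst (Band e₀ _) (+-inverseʳ x) (cumOn-Band-across k≤k′ x≤tk tk′≤x ≤-refl)))

  CumAt-unique : ∀ {x v w} → CumAt P x v → CumAt P x w → v ≡ w
  CumAt-unique (k , tk≤x , x≤tk , refl) (k′ , tk′≤x , x≤tk′ , refl) with ℕ.≤-total k k′
  ... | inj₁ k≤k′ = sym (cumOn-unique (ℕ.≤⇒≤′ k≤k′) x≤tk tk′≤x)
  ... | inj₂ k′≤k = cumOn-unique (ℕ.≤⇒≤′ k′≤k) x≤tk′ tk≤x

  segment-below : ∀ {x} K → 0ℚ ≤ x → x ≤ t P K → ∃[ k ] (t P k ≤ x × x ≤ t P (suc k))
  segment-below zero 0≤x x≤t₀ = 0 , subst (_≤ _) (sym (t₀ P)) 0≤x , ≤-trans x≤t₀ (<⇒≤ (t-inc P 0))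
  segment-below {x} (suc K) 0≤x x≤tK+1 with x ≤? t P K
  ... | yes x≤tK = segment-below K 0≤x x≤tK
  ... | no x≰tK = K , <⇒≤ (≰⇒> x≰tK) , x≤tK+1

  segment : ∀ x → 0ℚ ≤ x → ∃[ k ] (t P k ≤ x × x ≤ t P (suc k))
  segment x 0≤x = let K , x≤tK = t-unb P x in segment-below K 0≤x x≤tK

  cum : ℚ → ℚ
  cum x with 0ℚ ≤? x
  ... | yes 0≤x = cumOn (proj₁ (segment x 0≤x)) x
  ... | no _ = 0ℚ

  cum-CumAt : ∀ {x} → 0ℚ ≤ x → CumAt P x (cum x)
  cum-CumAt {x} 0≤x with 0ℚ ≤? x
  ... | yes 0≤x′ = let k , tk≤x , x≤tk = segment x 0≤x′ in k , tk≤x , x≤tk , refl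
  ... | no 0≰x = contradiction 0≤x 0≰x

  CumAt⇒≡cum : ∀ {x v} → CumAt P x v → v ≡ cum x
  CumAt⇒≡cum c = CumAt-unique c (cum-CumAt (CumAt⇒0≤ c))

  cum-0 : cum 0ℚ ≡ 0ℚ
  cum-0 = sym (CumAt⇒≡cum (0 , ≤-reflexive (t₀ P) , 0≤t₁ , 0≡cumOn0))
    where
    0≤t₁ : 0ℚ ≤ t P 1
    0≤t₁ = <⇒≤ (subst (_< t P 1) (t₀ P) (t-inc P 0))
    0≡cumOn0 : 0ℚ ≡ cumOn 0 0ℚ
    0≡cumOn0 rewrite t₀ P | *-zeroʳ (e P 0) = refl

  cum-Band : ∀ {x y} → 0ℚ ≤ x → x ≤ y → Band e₀ (cum y - cum x) (y - x)
  cum-Band {x} {y} 0≤x x≤y with cum-CumAt 0≤x | cum-CumAt (≤-trans 0≤x x≤y)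
  ... | k , tk≤x , x≤tk , cx | k′ , tk′≤y , y≤tk′ , cy with k ℕ.≤? k′
  ...   | yes k≤k′ = subst₂ (Band e₀) (sym (cong₂ _-_ cy cx)) refl
                       (cumOn-Band-across (ℕ.≤⇒≤′ k≤k′) x≤tk tk′≤y x≤y)
  ...   | no k≰k′ = subst (λ z → Band e₀ (cum z - cum x) (z - x)) x≡y
                      (subst₂ (Band e₀) (sym (+-inverseʳ (cum x))) (sym (+-inverseʳ x)) (Band-0 {e₀}))
    where
    x≡y : x ≡ y
    x≡y = ≤-antisym x≤y (≤-trans y≤tk′ (≤-trans (t-mono (ℕ.≤⇒≤′ (ℕ.≰⇒> k≰k′))) tk≤x))

  cum-mono : ∀ {x y} → 0ℚ ≤ x → x ≤ y → cum x ≤ cum y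
  cum-mono 0≤x x≤y = 0≤y-x⇒x≤y (Band-nonneg (<⇒≤ 0<e₀) (x≤y⇒0≤y-x x≤y) (cum-Band 0≤x x≤y))

  cum-strict : ∀ {x y} → 0ℚ ≤ x → x < y → cum x < cum y
  cum-strict 0≤x x<y = 0<y-x⇒x<y (Band-pos 0<e₀ (x<y⇒0<y-x x<y) (cum-Band 0≤x (<⇒≤ x<y)))

  cum-cancel-≤ : ∀ {x y} → 0ℚ ≤ y → cum x ≤ cum y → x ≤ y
  cum-cancel-≤ 0≤y cx≤cy = ≮⇒≥ (λ y<x → <-irrefl refl (<-≤-trans (cum-strict 0≤y y<x) cx≤cy))

  Completes⇒≡cum : ∀ {s p C} → Completes P s p C → p ≡ cum C - cum s
  Completes⇒≡cum (_ , _ , cs , cC , refl) = cong₂ _-_ (CumAt⇒≡cum cC) (CumAt⇒≡cum cs)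

  Completes⇒Band : ∀ {s p C} → 0ℚ ≤ p → Completes P s p C → Band e₀ p (C - s)
  Completes⇒Band 0≤p completes@(_ , _ , cs , cC , _) rewrite Completes⇒≡cum completes =
    cum-Band (CumAt⇒0≤ cs) (cum-cancel-≤ (CumAt⇒0≤ cC) (0≤y-x⇒x≤y 0≤p))

  Completes⇒≤bound* : ∀ {s p C T} → 0ℚ ≤ p → s ≤ T → p ≤ T → Completes P s p C →
                      C ≤ bound e₀ 0<e₀ * T
  Completes⇒≤bound* 0≤p s≤T p≤T completes =
    completion≤bound* 0<e₀ s≤T (≤-trans (proj₁ (Completes⇒Band 0≤p completes)) p≤T)

sum-mono-≤ : ∀ {n} {f g : Vector ℚ n} → (∀ i → f i ≤ g i) → sum f ≤ sum g
sum-mono-≤ {zero} _ = ≤-refl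
sum-mono-≤ {suc n} f≤g = +-mono-≤ (f≤g zero) (sum-mono-≤ (f≤g ∘ suc))

sum-mono-< : ∀ {n} {f g : Vector ℚ n} → Fin n → (∀ i → f i < g i) → sum f < sum g
sum-mono-< {suc n} _ f<g = +-mono-<-≤ (f<g zero) (sum-mono-≤ (<⇒≤ ∘ f<g ∘ suc))

sum-update : ∀ {n} {f g : Vector ℚ n} i {d} → g i ≡ f i + d → (∀ i′ → i′ ≢ i → g i′ ≡ f i′) →
             sum g ≡ sum f + d
sum-update {suc n} {f} {g} i {d} gi≡fi+d g≗f = begin
  sum g                          ≡⟨ sum-remove g ⟩
  g i + sum (g ∘ punchIn i)      ≡⟨ cong₂ _+_ gi≡fi+d (sum-cong-≗ (λ j → g≗f (punchIn i j) (punchInᵢ≢i i j))) ⟩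
  f i + d + sum (f ∘ punchIn i)  ≡⟨ solve 3 (λ a d b → a :+ d :+ b := a :+ b :+ d) refl (f i) d f′ ⟩
  f i + sum (f ∘ punchIn i) + d  ≡⟨ cong (_+ d) (sum-remove f) ⟨
  sum f + d                      ∎
  where
  open ≡-Reasoning
  f′ = sum (f ∘ punchIn i)

record DisjointIntervals (N : ℕ) : Set₁ where
  field
    left right weight : Fin N → ℚ
    Active            : Pred (Fin N) 0ℓ
    active?           : Decidable Active
    left<right        : ∀ j → left j < right j
    separated         : ∀ j j′ → j ≢ j′ → Active j → Active j′ →
                        right j ≤ left j′ ⊎ right j′ ≤ left j
open DisjointIntervals

rest : ∀ {N} → DisjointIntervals (suc N) → DisjointIntervals N
rest F = record
  { left       = left F ∘ suc
  ; right      = right F ∘ suc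
  ; weight     = weight F ∘ suc
  ; Active     = Active F ∘ suc
  ; active?    = active? F ∘ suc
  ; left<right = left<right F ∘ suc
  ; separated  = λ j j′ j≢j′ → separated F (suc j) (suc j′) (j≢j′ ∘ suc-injective)
  }

module _ {N} (F : DisjointIntervals N) where

  Inside : ℚ → ℚ → Pred (Fin N) 0ℓ
  Inside lo T j = Active F j × lo ≤ left F j × right F j ≤ T

  inside? : ∀ lo T → Decidable (Inside lo T)
  inside? lo T j = active? F j ×-dec lo ≤? left F j ×-dec right F j ≤? T

  contribution : ℚ → ℚ → Fin N → ℚ
  contribution lo T j = if does (inside? lo T j) then weight F j else 0ℚ

  load : ℚ → ℚ → ℚ
  load lo T = ∑[ j < N ] contribution lo T j

  contribution-inside : ∀ {lo T j} → Inside lo T j → contribution lo T j ≡ weight F j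
  contribution-inside {lo} {T} {j} inside =
    cong (if_then weight F j else 0ℚ) (dec-true (inside? lo T j) inside)

  contribution-outside : ∀ {lo T j} → ¬ Inside lo T j → contribution lo T j ≡ 0ℚ
  contribution-outside {lo} {T} {j} outside =
    cong (if_then weight F j else 0ℚ) (dec-false (inside? lo T j) outside)

contribution-split : ∀ {N} (F : DisjointIntervals (suc N)) {lo T} → Inside F lo T zero → ∀ j →
                     contribution (rest F) lo T j ≡
                     contribution (rest F) lo (left F zero) j + contribution (rest F) (right F zero) T j
contribution-split F {lo} {T} (a₀ , lo≤l₀ , r₀≤T) j = split (inside? G lo T j)
  where
  G = rest F
  l₀ = left F zero
  r₀ = right F zero
  l = left G j
  r = right G j
  l₀<r₀ = left<right F zero
  l<r = left<right G j

  before⇒inside : Inside G lo l₀ j → Inside G lo T j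
  before⇒inside (a , lo≤l , r≤l₀) = a , lo≤l , ≤-trans r≤l₀ (≤-trans (<⇒≤ l₀<r₀) r₀≤T)

  after⇒inside : Inside G r₀ T j → Inside G lo T j
  after⇒inside (a , r₀≤l , r≤T) = a , ≤-trans lo≤l₀ (≤-trans (<⇒≤ l₀<r₀) r₀≤l) , r≤T

  before⇒¬after : r ≤ l₀ → ¬ Inside G r₀ T j
  before⇒¬after r≤l₀ (_ , r₀≤l , _) = <-irrefl refl (begin-strict
    l <⟨ l<r ⟩ r ≤⟨ r≤l₀ ⟩ l₀ <⟨ l₀<r₀ ⟩ r₀ ≤⟨ r₀≤l ⟩ l ∎)
    where open ≤-Reasoning

  after⇒¬before : r₀ ≤ l → ¬ Inside G lo l₀ j
  after⇒¬before r₀≤l (_ , _ , r≤l₀) = <-irrefl refl (begin-strict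
    r ≤⟨ r≤l₀ ⟩ l₀ <⟨ l₀<r₀ ⟩ r₀ ≤⟨ r₀≤l ⟩ l <⟨ l<r ⟩ r ∎)
    where open ≤-Reasoning

  split : Dec (Inside G lo T j) →
          contribution G lo T j ≡ contribution G lo l₀ j + contribution G r₀ T j
  split (no outside) = begin
    contribution G lo T j
      ≡⟨ contribution-outside G outside ⟩
    0ℚ
      ≡⟨ +-identityʳ 0ℚ ⟨
    0ℚ + 0ℚ
      ≡⟨ cong₂ _+_ (contribution-outside G (outside ∘ before⇒inside))
                   (contribution-outside G (outside ∘ after⇒inside)) ⟨
    contribution G lo l₀ j + contribution G r₀ T j ∎
    where open ≡-Reasoning
  split (yes inside@(a , lo≤l , r≤T)) with separated F (suc j) zero (λ ()) a a₀
  ... | inj₁ r≤l₀ = begin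
    contribution G lo T j
      ≡⟨ contribution-inside G inside ⟩
    weight G j
      ≡⟨ +-identityʳ (weight G j) ⟨
    weight G j + 0ℚ
      ≡⟨ cong₂ _+_ (contribution-inside G (a , lo≤l , r≤l₀))
                   (contribution-outside G (before⇒¬after r≤l₀)) ⟨
    contribution G lo l₀ j + contribution G r₀ T j ∎
    where open ≡-Reasoning
  ... | inj₂ r₀≤l = begin
    contribution G lo T j
      ≡⟨ contribution-inside G inside ⟩
    weight G j
      ≡⟨ +-identityˡ (weight G j) ⟨
    0ℚ + weight G j
      ≡⟨ cong₂ _+_ (contribution-outside G (after⇒¬before r₀≤l))
                   (contribution-inside G (a , r₀≤l , r≤T)) ⟨
    contribution G lo l₀ j + contribution G r₀ T j ∎
    where open ≡-Reasoning

module _ (c : ℚ → ℚ) (c-mono : ∀ {x y} → 0ℚ ≤ x → x ≤ y → c x ≤ c y) where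

  -- The first interval inside [lo, T] takes its own capacity; by disjointness every other
  -- interval inside [lo, T] lies in the gap before it or in the gap after it.
  load≤capacity : ∀ {N} (F : DisjointIntervals N) →
                  (∀ j → Active F j → weight F j ≤ c (right F j) - c (left F j)) →
                  ∀ {lo T} → 0ℚ ≤ lo → lo ≤ T → load F lo T ≤ c T - c lo
  load≤capacity {zero} F _ 0≤lo lo≤T = x≤y⇒0≤y-x (c-mono 0≤lo lo≤T)
  load≤capacity {suc N} F weight≤ {lo} {T} 0≤lo lo≤T with inside? F lo T zero
  ... | no outside = begin
    contribution F lo T zero + load (rest F) lo T
      ≡⟨ cong (_+ load (rest F) lo T) (contribution-outside F outside) ⟩
    0ℚ + load (rest F) lo T
      ≡⟨ +-identityˡ (load (rest F) lo T) ⟩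
    load (rest F) lo T
      ≤⟨ load≤capacity (rest F) (weight≤ ∘ suc) 0≤lo lo≤T ⟩
    c T - c lo ∎
    where open ≤-Reasoning
  ... | yes inside@(a₀ , lo≤l₀ , r₀≤T) = begin
    contribution F lo T zero + load (rest F) lo T
      ≡⟨ cong₂ _+_ (contribution-inside F inside)
                   (trans (sum-cong-≗ (contribution-split F inside))
                          (∑-distrib-+ (contribution (rest F) lo l₀) (contribution (rest F) r₀ T))) ⟩
    weight F zero + (load (rest F) lo l₀ + load (rest F) r₀ T)
      ≤⟨ +-mono-≤ (weight≤ zero a₀) (+-mono-≤ (load≤capacity (rest F) (weight≤ ∘ suc) 0≤lo lo≤l₀)
                                               (load≤capacity (rest F) (weight≤ ∘ suc) 0≤r₀ r₀≤T)) ⟩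
    (c r₀ - c l₀) + ((c l₀ - c lo) + (c T - c r₀))
      ≡⟨ solve 4 (λ w x y z → (w :- x) :+ ((x :- y) :+ (z :- w)) := z :- y) refl
                 (c r₀) (c l₀) (c lo) (c T) ⟩
    c T - c lo ∎
    where
    open ≤-Reasoning
    l₀ = left F zero
    r₀ = right F zero
    0≤r₀ = ≤-trans 0≤lo (≤-trans lo≤l₀ (<⇒≤ (left<right F zero)))

update-≡ : ∀ {m} (a : Fin m → ℚ) i v → update a i v i ≡ v
update-≡ a i v with i ≟ i
... | yes _ = refl
... | no i≢i = contradiction refl i≢i

update-≢ : ∀ {m} (a : Fin m → ℚ) {i i′} v → i′ ≢ i → update a i v i′ ≡ a i′
update-≢ a {i} {i′} v i′≢i with i′ ≟ i
... | yes i′≡i = contradiction i′≡i i′≢i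
... | no _ = refl

≤-makespan : ∀ {n} (C : Fin n → ℚ) j → C j ≤ makespan C
≤-makespan {n} C j = go (allFin n) (∈-allFin j)
  where
  go : ∀ js → j ∈ js → C j ≤ foldr _⊔_ 0ℚ (map C js)
  go (k ∷ js) (here refl) = p≤p⊔q (C k) _
  go (k ∷ js) (there j∈js) = ≤-trans (go js j∈js) (p≤q⊔p (C k) _)

makespan-nonneg : ∀ {n} (C : Fin n → ℚ) → 0ℚ ≤ makespan C
makespan-nonneg {n} C = go (allFin n)
  where
  go : ∀ js → 0ℚ ≤ foldr _⊔_ 0ℚ (map C js)
  go [] = ≤-refl
  go (k ∷ js) = ≤-trans (go js) (p≤q⊔p (C k) _)

makespan-lub : ∀ {n} (C : Fin n → ℚ) {U} → 0ℚ ≤ U → (∀ j → C j ≤ U) → makespan C ≤ U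
makespan-lub {n} C {U} 0≤U C≤U = go (allFin n)
  where
  go : ∀ js → foldr _⊔_ 0ℚ (map C js) ≤ U
  go [] = 0≤U
  go (k ∷ js) = ⊔-lub (C≤U k) (go js)

module _ {m n} (I : Instance m n) where

  work : List (Fin n) → ℚ
  work js = foldr _+_ 0ℚ (map (p I) js)

  work-nonneg : ∀ js → 0ℚ ≤ work js
  work-nonneg [] = ≤-refl
  work-nonneg (j ∷ js) = +-mono-≤ (<⇒≤ (p-pos I j)) (work-nonneg js)

  work-↭ : ∀ {js ks} → js ↭ ks → work js ≡ work ks
  work-↭ js↭ks = foldr-commMonoid (setoid ℚ) +-0-isCommutativeMonoid (↭⇒↭ₛ (map⁺ (p I) js↭ks))

  work-tabulate : ∀ {k} (f : Fin k → Fin n) → work (tabulate f) ≡ ∑[ j < k ] p I (f j)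
  work-tabulate {zero} f = refl
  work-tabulate {suc k} f = cong (p I (f zero) +_) (work-tabulate (f ∘ suc))

module InstanceCapacity {m n} {e₀} (0<e₀ : 0ℚ < e₀) (I : Instance m n)
                        (e₀≤e : ∀ i k → e₀ ≤ e (prof I i) k) where

  module Machine (i : Fin m) = Capacity 0<e₀ (prof I i) (e₀≤e i)
  open Machine using (cum)

  capacity : (Fin m → ℚ) → ℚ
  capacity a = ∑[ i < m ] cum i (a i)

  capacity-0 : capacity (λ _ → 0ℚ) ≡ 0ℚ
  capacity-0 = trans (sum-cong-≗ (λ i → Machine.cum-0 i)) (sum-replicate-zero m)

  module _ (S : Schedule I) where

    processing-Band : ∀ j → Band e₀ (p I j) (finish S j - start S j)
    processing-Band j = Machine.Completes⇒Band (machine S j) (<⇒≤ (p-pos I j)) (completes S j)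

    processing≤finish : ∀ j → p I j ≤ finish S j
    processing≤finish j = ≤-trans (proj₂ (processing-Band j)) (y-x≤y (start≥0 S j))

    jobsOn : Fin m → DisjointIntervals n
    jobsOn i = record
      { left       = start S
      ; right      = finish S
      ; weight     = p I
      ; Active     = λ j → machine S j ≡ i
      ; active?    = λ j → machine S j ≟ i
      ; left<right = λ j → 0<y-x⇒x<y (<-≤-trans (p-pos I j) (proj₂ (processing-Band j)))
      ; separated  = λ j j′ j≢j′ j↦i j′↦i → disjoint S j j′ j≢j′ (trans j↦i (sym j′↦i))
      }

    total-processing≤capacity : ∀ {T} → 0ℚ ≤ T → (∀ j → finish S j ≤ T) →
                                ∑[ j < n ] p I j ≤ capacity (λ _ → T)
    total-processing≤capacity {T} 0≤T finish≤T = begin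
      ∑[ j < n ] p I j
        ≡⟨ sum-cong-≗ counted-once ⟨
      ∑[ j < n ] ∑[ i < m ] contribution (jobsOn i) 0ℚ T j
        ≡⟨ ∑-comm (λ i j → contribution (jobsOn i) 0ℚ T j) ⟨
      ∑[ i < m ] load (jobsOn i) 0ℚ T
        ≤⟨ sum-mono-≤ (λ i → load≤capacity (cum i) (Machine.cum-mono i) (jobsOn i) (weight≤ i) ≤-refl 0≤T) ⟩
      ∑[ i < m ] (cum i T - cum i 0ℚ)
        ≡⟨ sum-cong-≗ (λ i → trans (cong (λ c → cum i T - c) (Machine.cum-0 i)) (+-identityʳ (cum i T))) ⟩
      capacity (λ _ → T) ∎
      where
      open ≤-Reasoning hiding (start)
      weight≤ : ∀ i j → machine S j ≡ i → p I j ≤ cum i (finish S j) - cum i (start S j)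
      weight≤ i j refl = ≤-reflexive (Machine.Completes⇒≡cum i (completes S j))
      counted-once : ∀ j → ∑[ i < m ] contribution (jobsOn i) 0ℚ T j ≡ p I j
      counted-once j = begin-equality
        ∑[ i < m ] contribution (jobsOn i) 0ℚ T j   ≡⟨ sum-update (machine S j) on-machine off-machine ⟩
        ∑[ i < m ] 0ℚ + p I j                       ≡⟨ cong (_+ p I j) (sum-replicate-zero m) ⟩
        0ℚ + p I j                                  ≡⟨ +-identityˡ (p I j) ⟩
        p I j                                       ∎
        where
        on-machine : contribution (jobsOn (machine S j)) 0ℚ T j ≡ 0ℚ + p I j
        on-machine = trans (contribution-inside (jobsOn (machine S j)) (refl , start≥0 S j , finish≤T j))
                           (sym (+-identityˡ (p I j)))
        off-machine : ∀ i → i ≢ machine S j → contribution (jobsOn i) 0ℚ T j ≡ 0ℚ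
        off-machine i i≢ = contribution-outside (jobsOn i) {0ℚ} {T} (λ (j↦i , _) → i≢ (sym j↦i))

  earliest≤ : ∀ {a i T} → 0ℚ ≤ T → capacity a ≤ capacity (λ _ → T) → (∀ i′ → a i ≤ a i′) → a i ≤ T
  earliest≤ {a} {i} 0≤T used≤ earliest = ≮⇒≥ λ T<ai → <-irrefl refl (<-≤-trans
    (sum-mono-< i (λ i′ → Machine.cum-strict i′ 0≤T (<-≤-trans T<ai (earliest i′)))) used≤)

  capacity-update : ∀ {a i j v} → Completes (prof I i) (a i) (p I j) v →
                    capacity (update a i v) ≡ capacity a + p I j
  capacity-update {a} {i} {j} {v} completes =
    sum-update i (trans (cong (cum i) (update-≡ a i v)) cum-v)
                 (λ i′ i′≢i → cong (cum i′) (update-≢ a v i′≢i))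
    where
    cum-v : cum i v ≡ cum i (a i) + p I j
    cum-v = trans (sym (x+[y-x]≡y (cum i (a i)) (cum i v)))
                  (cong (cum i (a i) +_) (sym (Machine.Completes⇒≡cum i completes)))

  list-scheduling-starts-by : ∀ {a js C T} → 0ℚ ≤ T → ListSched I a js C → (∀ i → 0ℚ ≤ a i) →
                              capacity a + work I js ≤ capacity (λ _ → T) → ∀ {j} → j ∈ js →
                              ∃[ i ] ∃[ s ] (s ≤ T × Completes (prof I i) s (p I j) (C j))
  list-scheduling-starts-by 0≤T (step {a} {j} {js} i earliest completes _) _ budget (here refl) =
    i , a i , earliest≤ 0≤T (≤-trans used≤used+work budget) earliest , completes
    where
    used≤used+work : capacity a ≤ capacity a + work I (j ∷ js)
    used≤used+work = subst (_≤ capacity a + work I (j ∷ js)) (+-identityʳ (capacity a))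
                           (+-monoʳ-≤ (capacity a) (work-nonneg I (j ∷ js)))
  list-scheduling-starts-by {T = T} 0≤T (step {a} {j₀} {js} {C} i _ completes rest) 0≤a budget
                            (there j∈js) =
    list-scheduling-starts-by 0≤T rest 0≤a′ budget′ j∈js
    where
    0≤a′ : ∀ i′ → 0ℚ ≤ update a i (C j₀) i′
    0≤a′ i′ with i′ ≟ i
    ... | yes _ = let _ , _ , _ , C-at , _ = completes in Machine.CumAt⇒0≤ i C-at
    ... | no _ = 0≤a i′
    budget′ : capacity (update a i (C j₀)) + work I js ≤ capacity (λ _ → T)
    budget′ = subst (_≤ capacity (λ _ → T))
                    (trans (sym (+-assoc (capacity a) (p I j₀) (work I js)))
                           (cong (_+ work I js) (sym (capacity-update completes))))
                    budget

  list-scheduling-completes-by : ∀ {order C T} → 0ℚ ≤ T → ListSched I (λ _ → 0ℚ) order C →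
                                 order ↭ allFin n → ∑[ j < n ] p I j ≤ capacity (λ _ → T) →
                                 (∀ j → p I j ≤ T) → ∀ j → C j ≤ bound e₀ 0<e₀ * T
  list-scheduling-completes-by {order} {T = T} 0≤T ls order↭allFin total≤ p≤T j =
    let i , s , s≤T , completes = list-scheduling-starts-by 0≤T ls (λ _ → ≤-refl) budget
                                    (∈-resp-↭ (↭-sym order↭allFin) (∈-allFin j))
    in Machine.Completes⇒≤bound* i (<⇒≤ (p-pos I j)) s≤T (p≤T j) completes
    where
    open ≤-Reasoning
    budget : capacity (λ _ → 0ℚ) + work I order ≤ capacity (λ _ → T)
    budget = begin
      capacity (λ _ → 0ℚ) + work I order
        ≡⟨ cong₂ _+_ capacity-0 (trans (work-↭ I order↭allFin) (work-tabulate I id)) ⟩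
      0ℚ + ∑[ j < n ] p I j
        ≡⟨ +-identityˡ (∑[ j < n ] p I j) ⟩
      ∑[ j < n ] p I j
        ≤⟨ total≤ ⟩
      capacity (λ _ → T) ∎

theorem2 : (e₀ : ℚ) (e₀>0 : 0ℚ < e₀) → e₀ ≤ 1ℚ →
    ∀ {m n} (I : Instance m n) →
    (∀ i k → e₀ ≤ e (prof I i) k) →
    (order : List (Fin n)) → order ↭ allFin n →
    (C : Fin n → ℚ) → ListSched I (λ _ → 0ℚ) order C →
    (S : Schedule I) →
    makespan C ≤ bound e₀ e₀>0 * makespan (finish S)
theorem2 e₀ 0<e₀ _ I e₀≤e order order↭allFin C ls S =
  makespan-lub C (0≤bound* 0<e₀ 0≤C*)
    (list-scheduling-completes-by 0≤C* ls order↭allFin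
      (total-processing≤capacity S 0≤C* (≤-makespan (finish S)))
      (λ j → ≤-trans (processing≤finish S j) (≤-makespan (finish S) j)))
  where
  open InstanceCapacity 0<e₀ I e₀≤e
  C* = makespan (finish S)
  0≤C* = makespan-nonneg (finish S)
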